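{- Let $G$ be a finite nilpotent group of order $n=p_1^{\alpha_1}\cdots p_r^{\alpha_r}$ with $p_1<\cdots<p_r$ primes, $\alpha_i\ge1$, $r\geq2$, and let $P_i$ be the Sylow $p_i$-subgroup of $G$. For any $\langle y\rangle\in\mathcal{M}(G)$: (i) If $P_k$ is noncyclic for some $k\in[r]$, then $\deg(y)<\deg(y_j)$ for every $j\in[r]\setminus\{k\}$. (ii) If $P_k$ and $P_l$ are noncyclic for distinct $k,l\in[r]$, then $\deg(y)<\deg(y_i)$ for every $i\in[r]$.
   Context: The power graph $\mathcal{P}(G)$ has vertex set $G$, with two distinct vertices adjacent iff one is a positive power of the other; $\deg$ denotes degree in $\mathcal{P}(G)$. $\mathcal{M}(G)$ is the set of maximal cyclic subgroups of $G$ (cyclic subgroups not properly contained in any cyclic subgroup). Every $y\in G$ is written uniquely as $y=y_1y_2\cdots y_r$ with $y_i\in P_i$. $[r]=\{1,\ldots,r\}$. -}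

module Defs where

open import Data.Nat using (ℕ; zero; suc; _*_; _^_; _≤_)
open import Data.Fin using (Fin) renaming (zero to fzero; suc to fsuc)
open import Data.Fin.Properties using (_≟_)
open import Data.Bool using (Bool; true; false; not; _∧_; _∨_)
open import Data.List using (List; length; filterᵇ; allFin; map; upTo)
open import Data.Bool.ListAction using (any)
open import Data.Product using (Σ; ∃; _×_)
open import Relation.Nullary using (¬_; does)
open import Relation.Binary.PropositionalEquality using (_≡_)

record FinGroup (n : ℕ) : Set where
  infixl 7 _∙_
  field
    _∙_   : Fin n → Fin n → Fin n
    ε     : Fin n
    _⁻¹   : Fin n → Fin n
    assoc : ∀ x y z → (x ∙ y) ∙ z ≡ x ∙ (y ∙ z)
    idˡ   : ∀ x → ε ∙ x ≡ x
    idʳ   : ∀ x → x ∙ ε ≡ x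
    invˡ  : ∀ x → (x ⁻¹) ∙ x ≡ ε
    invʳ  : ∀ x → x ∙ (x ⁻¹) ≡ ε

module _ {n : ℕ} (G : FinGroup n) where
  open FinGroup G

  pow : Fin n → ℕ → Fin n
  pow x zero    = ε
  pow x (suc k) = x ∙ pow x k

  comm : Fin n → Fin n → Fin n
  comm g h = (g ⁻¹) ∙ (h ⁻¹) ∙ g ∙ h

  UpperCentral : ℕ → Fin n → Set
  UpperCentral zero    g = g ≡ ε
  UpperCentral (suc i) g = ∀ h → UpperCentral i (comm g h)

  Nilpotent : Set
  Nilpotent = ∃ λ c → ∀ g → UpperCentral c g

  card : (Fin n → Bool) → ℕ
  card S = length (filterᵇ S (allFin n))

  IsSubgroup : (Fin n → Bool) → Set
  IsSubgroup S = S ε ≡ true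
               × (∀ x y → S x ≡ true → S y ≡ true → S (x ∙ y) ≡ true)
               × (∀ x → S x ≡ true → S (x ⁻¹) ≡ true)

  -- S is a Sylow p-subgroup, where |G| = p^α · m with p ∤ m
  IsSylow : ℕ → ℕ → (Fin n → Bool) → Set
  IsSylow p α S = IsSubgroup S × card S ≡ p ^ α

  InCyc : Fin n → Fin n → Set
  InCyc x g = ∃ λ k → g ≡ pow x k

  CyclicSub : (Fin n → Bool) → Set
  CyclicSub S = Σ (Fin n) λ g → S g ≡ true × (∀ h → S h ≡ true → InCyc g h)

  MaxCyclic : Fin n → Set
  MaxCyclic y = ∀ z → (∀ g → InCyc y g → InCyc z g) → (∀ g → InCyc z g → InCyc y g)

  -- y is a positive power of x; since |G| = n, {x^k : k ≥ 1} = {x^k : 1 ≤ k ≤ n}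
  isPosPowerOf : Fin n → Fin n → Bool
  isPosPowerOf y x = any (λ k → does (y ≟ pow x (suc k))) (upTo n)

  adj : Fin n → Fin n → Bool
  adj x y = not (does (x ≟ y)) ∧ (isPosPowerOf y x ∨ isPosPowerOf x y)

  deg : Fin n → ℕ
  deg x = card (adj x)

  prodG : ∀ {r} → (Fin r → Fin n) → Fin n
  prodG {zero}  f = ε
  prodG {suc r} f = f fzero ∙ prodG (λ i → f (fsuc i))

prodℕ : ∀ {r} → (Fin r → ℕ) → ℕ
prodℕ {zero}  f = 1
prodℕ {suc r} f = f fzero * prodℕ (λ i → f (fsuc i))

module Submission where

-- If ⟨y⟩ is a maximal cyclic subgroup, every neighbour of y in 𝒫(G) lies in ⟨y⟩, so deg y < |⟨y⟩|.
-- In a nilpotent group Sylow subgroups for distinct primes commute, and a suitable power y ^ C j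
-- (C j ≡ 1 mod |P j|, C j ≡ 0 mod |P i| for i ≠ j) is the component y j. A noncyclic P k contains
-- some z ∉ ⟨y⟩; for j ≠ k, ⟨y⟩ then injects into the neighbourhood of y j: y j ↦ 1, elements having
-- y j as a power stay, and any other a ↦ a y j z, of which y j is a power because (a y j z) ^ C j
-- is a generator of ⟨y j⟩. Hence |⟨y⟩| ≤ deg y j, which is (i); (ii) is (i) for whichever of k, l
-- differs from i.

open import Defs
open import Level using (0ℓ)
open import Algebra.Bundles using (Group)
import Algebra.Properties.Group as GroupProperties
open import Data.Nat using (ℕ; zero; suc; _+_; _*_; _^_; _∸_; _≤_; _<_; s≤s; z≤n)
open import Data.Nat.Properties
  using (+-comm; +-suc; +-identityʳ; *-comm; *-assoc; ≤-refl; ≤-trans; <-trans; ≤-<-trans; <-≤-trans; ≤-pred;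
         <⇒≤; <⇒≢; n<1+n; m<n⇒m<1+n; n≤0⇒n≡0; m≤n⇒m<n∨m≡n; m+n≤o⇒m≤o; m∸n+n≡m; m∸n≤m; m<n⇒0<n∸m)
open import Data.Nat.Divisibility
  using (_∣_; _∣?_; divides; _∣0; ∣-refl; ∣-trans; ∣1⇒≡1; m∣m*n; n∣m*n; ∣m∣n⇒∣m+n; ∣m+n∣m⇒∣n)
open import Data.Nat.DivMod using (_%_; _/_; m≡m%n+[m/n]*n; m%n<n)
open import Data.Nat.GCD using (module Bézout)
open import Data.Nat.Coprimality as Coprime using (Coprime; coprime-Bézout; coprime-divisor; 1-coprimeTo)
open import Data.Nat.Primality using (Prime; prime⇒irreducible; ¬prime[1])
open import Data.Fin using (Fin; toℕ; fromℕ<) renaming (zero to fzero; suc to fsuc; _<_ to _<ᶠ_)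
open import Data.Fin.Properties
  using (_≟_; suc-injective; toℕ<n; toℕ-fromℕ<; any?; pigeonhole; injective⇒≤) renaming (<-cmp to <-cmpᶠ)
import Data.Bool as Bool
open import Data.Bool using (Bool; true; false; not; _∧_; _∨_; T; if_then_else_)
open import Data.Bool.Properties using (T-≡; ∨-zeroʳ; ∧-zeroʳ)
open import Data.List using (List; []; _∷_; _++_; [_]; foldr; upTo; length; filterᵇ; allFin; lookup)
open import Data.List.Membership.Propositional using (_∈_; _∉_; lose)
open import Data.List.Membership.Propositional.Properties using (∈-upTo⁺; ∈-allFin; ∈-filter⁺; ∈-filter⁻; ∈-lookup)
open import Data.List.Relation.Unary.Any using (here; there; index; satisfied)
open import Data.List.Relation.Unary.Any.Properties using (lookup-index; any⁺; any⁻)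
import Data.List.Relation.Unary.All as All
open import Data.List.Relation.Unary.AllPairs using (_∷_)
open import Data.List.Relation.Unary.Unique.Propositional using (Unique)
import Data.List.Relation.Unary.Unique.Propositional.Properties as Unique
open import Data.Vec as Vec using ([]; _∷_)
open import Data.Vec.Functional using (updateAt)
open import Data.Vec.Functional.Properties using (updateAt-updates; updateAt-minimal)
open import Data.Product using (∃; _×_; _,_; proj₁; proj₂)
open import Data.Sum using (_⊎_; inj₁; inj₂)
open import Data.Empty using (⊥-elim)
open import Function using (id; _∘_; case_of_)
open import Function.Bundles using (Equivalence)
open import Relation.Nullary using (¬_; Dec; yes; no; does)
open import Relation.Nullary.Decidable using (⌊_⌋; map′; dec-true; T?; _×-dec_; ¬?; toWitness; fromWitness)
open import Relation.Binary.Definitions using (tri<; tri≈; tri>)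
open import Relation.Binary.PropositionalEquality
  using (_≡_; _≢_; ≢-sym; refl; sym; trans; cong; cong₂; subst; isEquivalence; module ≡-Reasoning)

module _ {n : ℕ} (G : FinGroup n) where
  open FinGroup G

  toGroup : Group 0ℓ 0ℓ
  toGroup = record
    { isGroup = record
      { isMonoid = record
        { isSemigroup = record
          { isMagma = record { isEquivalence = isEquivalence ; ∙-cong = cong₂ _∙_ }
          ; assoc = assoc }
        ; identity = idˡ , idʳ }
      ; inverse = invˡ , invʳ
      ; ⁻¹-cong = cong _⁻¹ } }

-- A sound test for group identities: both sides are flattened to letters and freely reduced.
module GroupWords {n : ℕ} (G : FinGroup n) where
  open FinGroup G
  open GroupProperties (toGroup G)

  infixl 7 _·_
  data Word (k : ℕ) : Set where
    var : Fin k → Word k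
    one : Word k
    _·_ : Word k → Word k → Word k
    inv : Word k → Word k

  -- a letter (i , true) stands for the generator i, (i , false) for its inverse
  Letter : ℕ → Set
  Letter k = Fin k × Bool

  invert : ∀ {k} → List (Letter k) → List (Letter k)
  invert []             = []
  invert ((i , b) ∷ ls) = invert ls ++ [ (i , not b) ]

  flatten : ∀ {k} → Word k → List (Letter k)
  flatten (var i) = [ (i , true) ]
  flatten one     = []
  flatten (u · v) = flatten u ++ flatten v
  flatten (inv u) = invert (flatten u)

  cons : ∀ {k} → Letter k → List (Letter k) → List (Letter k)
  cons l [] = l ∷ []
  cons (i , b) ((j , c) ∷ ls) with i ≟ j | b | c
  ... | yes _ | true  | false = ls
  ... | yes _ | false | true  = ls
  ... | _     | b′    | c′    = (i , b′) ∷ (j , c′) ∷ ls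

  reduce : ∀ {k} → List (Letter k) → List (Letter k)
  reduce = foldr cons []

  module _ {k : ℕ} (ρ : Fin k → Fin n) where
    ⟦_⟧ : Word k → Fin n
    ⟦ var i ⟧ = ρ i
    ⟦ one ⟧   = ε
    ⟦ u · v ⟧ = ⟦ u ⟧ ∙ ⟦ v ⟧
    ⟦ inv u ⟧ = ⟦ u ⟧ ⁻¹

    ⟦_⟧ˡ : Letter k → Fin n
    ⟦ i , true ⟧ˡ  = ρ i
    ⟦ i , false ⟧ˡ = ρ i ⁻¹

    ⟦_⟧* : List (Letter k) → Fin n
    ⟦ [] ⟧*     = ε
    ⟦ l ∷ ls ⟧* = ⟦ l ⟧ˡ ∙ ⟦ ls ⟧*

    ⟦⟧*-++ : ∀ ls ms → ⟦ ls ++ ms ⟧* ≡ ⟦ ls ⟧* ∙ ⟦ ms ⟧*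
    ⟦⟧*-++ []       ms = sym (idˡ _)
    ⟦⟧*-++ (l ∷ ls) ms = trans (cong (⟦ l ⟧ˡ ∙_) (⟦⟧*-++ ls ms)) (sym (assoc _ _ _))

    ⟦⟧ˡ-flip : ∀ i b → ⟦ i , not b ⟧ˡ ≡ ⟦ i , b ⟧ˡ ⁻¹
    ⟦⟧ˡ-flip i true  = refl
    ⟦⟧ˡ-flip i false = sym (⁻¹-involutive _)

    invert-sound : ∀ ls → ⟦ invert ls ⟧* ≡ ⟦ ls ⟧* ⁻¹
    invert-sound []             = sym ε⁻¹≈ε
    invert-sound ((i , b) ∷ ls) = begin
      ⟦ invert ls ++ [ (i , not b) ] ⟧*     ≡⟨ ⟦⟧*-++ (invert ls) [ (i , not b) ] ⟩
      ⟦ invert ls ⟧* ∙ (⟦ i , not b ⟧ˡ ∙ ε)  ≡⟨ cong₂ _∙_ (invert-sound ls) (trans (idʳ _) (⟦⟧ˡ-flip i b)) ⟩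
      ⟦ ls ⟧* ⁻¹ ∙ ⟦ i , b ⟧ˡ ⁻¹             ≡⟨ sym (⁻¹-anti-homo-∙ _ _) ⟩
      (⟦ i , b ⟧ˡ ∙ ⟦ ls ⟧*) ⁻¹              ∎
      where open ≡-Reasoning

    flatten-sound : ∀ u → ⟦ flatten u ⟧* ≡ ⟦ u ⟧
    flatten-sound (var i) = idʳ _
    flatten-sound one     = refl
    flatten-sound (u · v) = trans (⟦⟧*-++ (flatten u) (flatten v)) (cong₂ _∙_ (flatten-sound u) (flatten-sound v))
    flatten-sound (inv u) = trans (invert-sound (flatten u)) (cong _⁻¹ (flatten-sound u))

    cons-sound : ∀ l ls → ⟦ cons l ls ⟧* ≡ ⟦ l ⟧ˡ ∙ ⟦ ls ⟧*
    cons-sound l [] = refl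
    cons-sound (i , b) ((j , c) ∷ ls) with i ≟ j | b | c
    ... | yes refl | true  | false = sym (\\-leftDividesˡ (ρ i) _)
    ... | yes refl | false | true  = sym (\\-leftDividesʳ (ρ i) _)
    ... | yes refl | true  | true  = refl
    ... | yes refl | false | false = refl
    ... | no _     | true  | _     = refl
    ... | no _     | false | _     = refl

    reduce-sound : ∀ ls → ⟦ reduce ls ⟧* ≡ ⟦ ls ⟧*
    reduce-sound []       = refl
    reduce-sound (l ∷ ls) = trans (cons-sound l (reduce ls)) (cong (⟦ l ⟧ˡ ∙_) (reduce-sound ls))

    solve : ∀ u v → reduce (flatten u) ≡ reduce (flatten v) → ⟦ u ⟧ ≡ ⟦ v ⟧
    solve u v eq = begin
      ⟦ u ⟧                    ≡⟨ sym (flatten-sound u) ⟩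
      ⟦ flatten u ⟧*           ≡⟨ sym (reduce-sound (flatten u)) ⟩
      ⟦ reduce (flatten u) ⟧*  ≡⟨ cong ⟦_⟧* eq ⟩
      ⟦ reduce (flatten v) ⟧*  ≡⟨ reduce-sound (flatten v) ⟩
      ⟦ flatten v ⟧*           ≡⟨ flatten-sound v ⟩
      ⟦ v ⟧                    ∎
      where open ≡-Reasoning

module Powers {n : ℕ} (G : FinGroup n) where
  open FinGroup G
  open GroupProperties (toGroup G)
  open ≡-Reasoning

  pow-+ : ∀ x a b → pow G x (a + b) ≡ pow G x a ∙ pow G x b
  pow-+ x zero    b = sym (idˡ _)
  pow-+ x (suc a) b = trans (cong (x ∙_) (pow-+ x a b)) (sym (assoc _ _ _))

  pow-*ˡ : ∀ x a b → pow G x (a * b) ≡ pow G (pow G x b) a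
  pow-*ˡ x zero    b = refl
  pow-*ˡ x (suc a) b = trans (pow-+ x b (a * b)) (cong (pow G x b ∙_) (pow-*ˡ x a b))

  pow-* : ∀ x a b → pow G x (a * b) ≡ pow G (pow G x a) b
  pow-* x a b = trans (cong (pow G x) (*-comm a b)) (pow-*ˡ x b a)

  pow-pow-comm : ∀ x a b → pow G (pow G x a) b ≡ pow G (pow G x b) a
  pow-pow-comm x a b = trans (sym (pow-* x a b)) (pow-*ˡ x a b)

  pow-ε : ∀ k → pow G ε k ≡ ε
  pow-ε zero    = refl
  pow-ε (suc k) = trans (idˡ _) (pow-ε k)

  pow-multiple : ∀ x m q → pow G x m ≡ ε → pow G x (q * m) ≡ ε
  pow-multiple x m q xᵐ≡ε = trans (pow-*ˡ x q m) (trans (cong (λ u → pow G u q) xᵐ≡ε) (pow-ε q))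

  pow-1 : ∀ x → pow G x 1 ≡ x
  pow-1 = idʳ

  pow-sucʳ : ∀ x k → pow G x (suc k) ≡ pow G x k ∙ x
  pow-sucʳ x k = trans (cong (pow G x) (+-comm 1 k)) (trans (pow-+ x k 1) (cong (pow G x k ∙_) (idʳ x)))

  pow-⁻¹ : ∀ x k → pow G (x ⁻¹) k ≡ pow G x k ⁻¹
  pow-⁻¹ x zero    = sym ε⁻¹≈ε
  pow-⁻¹ x (suc k) = begin
    x ⁻¹ ∙ pow G (x ⁻¹) k  ≡⟨ cong (x ⁻¹ ∙_) (pow-⁻¹ x k) ⟩
    x ⁻¹ ∙ pow G x k ⁻¹    ≡⟨ sym (⁻¹-anti-homo-∙ (pow G x k) x) ⟩
    (pow G x k ∙ x) ⁻¹     ≡⟨ cong _⁻¹ (sym (pow-sucʳ x k)) ⟩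
    pow G x (suc k) ⁻¹     ∎

  Commute : Fin n → Fin n → Set
  Commute a b = a ∙ b ≡ b ∙ a

  commute-ε : ∀ a → Commute a ε
  commute-ε a = trans (idʳ a) (sym (idˡ a))

  commute-∙ : ∀ {a b c} → Commute a b → Commute a c → Commute a (b ∙ c)
  commute-∙ {a} {b} {c} ab ac = begin
    a ∙ (b ∙ c)  ≡⟨ sym (assoc _ _ _) ⟩
    a ∙ b ∙ c    ≡⟨ cong (_∙ c) ab ⟩
    b ∙ a ∙ c    ≡⟨ assoc _ _ _ ⟩
    b ∙ (a ∙ c)  ≡⟨ cong (b ∙_) ac ⟩
    b ∙ (c ∙ a)  ≡⟨ sym (assoc _ _ _) ⟩
    b ∙ c ∙ a    ∎

  commute-powʳ : ∀ {a b} → Commute a b → ∀ k → Commute a (pow G b k)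
  commute-powʳ {a} ab zero    = commute-ε a
  commute-powʳ     ab (suc k) = commute-∙ ab (commute-powʳ ab k)

  pow-∙ : ∀ {a b} → Commute a b → ∀ k → pow G (a ∙ b) k ≡ pow G a k ∙ pow G b k
  pow-∙         ab zero    = sym (idˡ ε)
  pow-∙ {a} {b} ab (suc k) = begin
    (a ∙ b) ∙ pow G (a ∙ b) k            ≡⟨ cong ((a ∙ b) ∙_) (pow-∙ ab k) ⟩
    (a ∙ b) ∙ (pow G a k ∙ pow G b k)    ≡⟨ assoc _ _ _ ⟩
    a ∙ (b ∙ (pow G a k ∙ pow G b k))    ≡⟨ cong (a ∙_) (sym (assoc _ _ _)) ⟩
    a ∙ ((b ∙ pow G a k) ∙ pow G b k)    ≡⟨ cong (λ u → a ∙ (u ∙ pow G b k)) (commute-powʳ (sym ab) k) ⟩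
    a ∙ ((pow G a k ∙ b) ∙ pow G b k)    ≡⟨ cong (a ∙_) (assoc _ _ _) ⟩
    a ∙ (pow G a k ∙ (b ∙ pow G b k))    ≡⟨ sym (assoc _ _ _) ⟩
    (a ∙ pow G a k) ∙ (b ∙ pow G b k)    ∎

module CyclicSubgroups {n : ℕ} (G : FinGroup n) where
  open FinGroup G
  open GroupProperties (toGroup G)
  open Powers G
  open ≡-Reasoning

  -- by pigeonhole among x⁰, …, xⁿ
  period : ∀ x → ∃ λ o → suc o ≤ n × pow G x (suc o) ≡ ε
  period x with pigeonhole (n<1+n n) (λ (i : Fin (suc n)) → pow G x (toℕ i))
  ... | i , j , i<j , xⁱ≡xʲ = positive (toℕ j ∸ toℕ i) refl
    where
    xʲ⁻ⁱ≡ε : pow G x (toℕ j ∸ toℕ i) ≡ ε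
    xʲ⁻ⁱ≡ε = ∙-cancelʳ (pow G x (toℕ i)) _ _ (begin
      pow G x (toℕ j ∸ toℕ i) ∙ pow G x (toℕ i)  ≡⟨ sym (pow-+ x (toℕ j ∸ toℕ i) (toℕ i)) ⟩
      pow G x (toℕ j ∸ toℕ i + toℕ i)            ≡⟨ cong (pow G x) (m∸n+n≡m (<⇒≤ i<j)) ⟩
      pow G x (toℕ j)                            ≡⟨ sym xⁱ≡xʲ ⟩
      pow G x (toℕ i)                            ≡⟨ sym (idˡ _) ⟩
      ε ∙ pow G x (toℕ i)                        ∎)
    positive : ∀ d → d ≡ toℕ j ∸ toℕ i → ∃ λ o → suc o ≤ n × pow G x (suc o) ≡ ε
    positive zero    d≡ = ⊥-elim (<⇒≢ (m<n⇒0<n∸m i<j) d≡)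
    positive (suc o) d≡ = o , ≤-trans (subst (_≤ toℕ j) (sym d≡) (m∸n≤m (toℕ j) (toℕ i))) (≤-pred (toℕ<n j))
                            , trans (cong (pow G x) d≡) xʲ⁻ⁱ≡ε

  pow-mod : ∀ x o → pow G x (suc o) ≡ ε → ∀ m → pow G x m ≡ pow G x (m % suc o)
  pow-mod x o xᵒ≡ε m = begin
    pow G x m                                           ≡⟨ cong (pow G x) (m≡m%n+[m/n]*n m (suc o)) ⟩
    pow G x (m % suc o + (m / suc o) * suc o)           ≡⟨ pow-+ x (m % suc o) _ ⟩
    pow G x (m % suc o) ∙ pow G x ((m / suc o) * suc o) ≡⟨ cong (pow G x (m % suc o) ∙_) (pow-multiple x (suc o) (m / suc o) xᵒ≡ε) ⟩
    pow G x (m % suc o) ∙ ε                             ≡⟨ idʳ _ ⟩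
    pow G x (m % suc o)                                 ∎

  InCyc? : ∀ x g → Dec (InCyc G x g)
  InCyc? x g with period x
  ... | o , _ , xᵒ≡ε = map′ to from (any? (λ (i : Fin (suc o)) → g ≟ pow G x (toℕ i)))
    where
    to : ∃ (λ i → g ≡ pow G x (toℕ i)) → InCyc G x g
    to (i , g≡) = toℕ i , g≡
    from : InCyc G x g → ∃ (λ i → g ≡ pow G x (toℕ i))
    from (m , g≡) = fromℕ< (m%n<n m (suc o))
                  , trans g≡ (trans (pow-mod x o xᵒ≡ε m) (cong (pow G x) (sym (toℕ-fromℕ< (m%n<n m (suc o))))))

  InCyc-refl : ∀ x → InCyc G x x
  InCyc-refl x = 1 , sym (pow-1 x)

  InCyc-ε : ∀ x → InCyc G x ε
  InCyc-ε x = 0 , refl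

  InCyc-∙ : ∀ {x a b} → InCyc G x a → InCyc G x b → InCyc G x (a ∙ b)
  InCyc-∙ {x} (s , refl) (t , refl) = s + t , sym (pow-+ x s t)

  InCyc-trans : ∀ {x y a} → InCyc G x y → InCyc G y a → InCyc G x a
  InCyc-trans {x} (s , refl) (t , refl) = s * t , sym (pow-* x s t)

  InCyc-⁻¹ : ∀ {x a} → InCyc G x a → InCyc G x (a ⁻¹)
  InCyc-⁻¹ {x} (s , refl) with period x
  ... | o , _ , xᵒ≡ε = s * o , sym (inverseʳ-unique (pow G x s) _ (begin
    pow G x s ∙ pow G x (s * o)  ≡⟨ sym (pow-+ x s (s * o)) ⟩
    pow G x (s + s * o)          ≡⟨ cong (pow G x) (trans (cong (s +_) (*-comm s o)) (*-comm (suc o) s)) ⟩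
    pow G x (s * suc o)          ≡⟨ pow-multiple x (suc o) s xᵒ≡ε ⟩
    ε                            ∎))

  InCyc-cancelˡ : ∀ {x a b c} → InCyc G x a → InCyc G x b → a ∙ c ≡ b → InCyc G x c
  InCyc-cancelˡ {x} {a} {b} {c} a∈ b∈ a∙c≡b =
    subst (InCyc G x) (trans (cong (a ⁻¹ ∙_) (sym a∙c≡b)) (\\-leftDividesʳ a c)) (InCyc-∙ (InCyc-⁻¹ a∈) b∈)

  isPosPowerOf⇒InCyc : ∀ a x → isPosPowerOf G a x ≡ true → InCyc G x a
  isPosPowerOf⇒InCyc a x isPow with satisfied (any⁻ _ (upTo n) (Equivalence.from T-≡ isPow))
  ... | k , _ with a ≟ pow G x (suc k)
  ...   | yes a≡xᵏ⁺¹ = suc k , a≡xᵏ⁺¹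

  InCyc⇒isPosPowerOf : ∀ a x → InCyc G x a → isPosPowerOf G a x ≡ true
  InCyc⇒isPosPowerOf a x (m , a≡xᵐ) with period x
  ... | o , o<n , xᵒ≡ε = listed (m % suc o) refl
    where
    a≡xʳ : a ≡ pow G x (m % suc o)
    a≡xʳ = trans a≡xᵐ (pow-mod x o xᵒ≡ε m)
    found : ∀ s → s < n → a ≡ pow G x (suc s) → isPosPowerOf G a x ≡ true
    found s s<n a≡ = Equivalence.to T-≡ (any⁺ _ (lose (∈-upTo⁺ s<n) (Equivalence.from T-≡ (dec-true (a ≟ pow G x (suc s)) a≡))))
    listed : ∀ r → r ≡ m % suc o → isPosPowerOf G a x ≡ true
    listed zero    r≡ = found o o<n (trans a≡xʳ (trans (cong (pow G x) (sym r≡)) (sym xᵒ≡ε)))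
    listed (suc s) r≡ = found s (<-trans (≤-pred (subst (_< suc o) (sym r≡) (m%n<n m (suc o)))) o<n)
                              (trans a≡xʳ (cong (pow G x) (sym r≡)))

module Counting {n : ℕ} where

  singleton : Fin n → Fin n → Bool
  singleton b a = does (a ≟ b)

  private
    count : (Fin n → Bool) → List (Fin n) → ℕ
    count S xs = length (filterᵇ S xs)

    count-cong : ∀ S U xs → (∀ a → S a ≡ U a) → count S xs ≡ count U xs
    count-cong S U []       S≗U = refl
    count-cong S U (x ∷ xs) S≗U with S x | U x | S≗U x
    ... | true  | true  | refl = cong suc (count-cong S U xs S≗U)
    ... | false | false | refl = count-cong S U xs S≗U

    count-∨ : ∀ S U xs → (∀ a → S a ∧ U a ≡ false) → count (λ a → S a ∨ U a) xs ≡ count S xs + count U xs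
    count-∨ S U []       disj = refl
    count-∨ S U (x ∷ xs) disj with S x | U x | disj x
    ... | true  | false | _ = cong suc (count-∨ S U xs disj)
    ... | false | true  | _ = trans (cong suc (count-∨ S U xs disj)) (sym (+-suc _ _))
    ... | false | false | _ = count-∨ S U xs disj

    count-empty : ∀ S xs → (∀ a → S a ≡ false) → count S xs ≡ 0
    count-empty S []       S≗∅ = refl
    count-empty S (x ∷ xs) S≗∅ with S x | S≗∅ x
    ... | false | _ = count-empty S xs S≗∅

    count-absent : ∀ b xs → b ∉ xs → count (singleton b) xs ≡ 0
    count-absent b []       b∉ = refl
    count-absent b (x ∷ xs) b∉ with x ≟ b
    ... | yes refl = ⊥-elim (b∉ (here refl))
    ... | no _     = count-absent b xs (b∉ ∘ there)

    count-singleton : ∀ b xs → Unique xs → b ∈ xs → count (singleton b) xs ≡ 1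
    count-singleton b (x ∷ xs) (x∉xs ∷ _) b∈ with x ≟ b
    ... | yes refl = cong suc (count-absent b xs (λ b∈xs → All.lookup x∉xs b∈xs refl))
    count-singleton b (x ∷ xs) (_ ∷ xs!) (here refl)  | no x≢b = ⊥-elim (x≢b refl)
    count-singleton b (x ∷ xs) (_ ∷ xs!) (there b∈xs) | no _   = count-singleton b xs xs! b∈xs

    lookup-injective : ∀ (xs : List (Fin n)) → Unique xs → ∀ i j → lookup xs i ≡ lookup xs j → i ≡ j
    lookup-injective (x ∷ xs) (x∉ ∷ xs!) fzero    fzero    _  = refl
    lookup-injective (x ∷ xs) (x∉ ∷ xs!) fzero    (fsuc j) eq = ⊥-elim (All.lookup x∉ (∈-lookup j) eq)
    lookup-injective (x ∷ xs) (x∉ ∷ xs!) (fsuc i) fzero    eq = ⊥-elim (All.lookup x∉ (∈-lookup i) (sym eq))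
    lookup-injective (x ∷ xs) (x∉ ∷ xs!) (fsuc i) (fsuc j) eq = cong fsuc (lookup-injective xs xs! i j eq)

  module _ (G : FinGroup n) where

    card-cong : ∀ S U → (∀ a → S a ≡ U a) → card G S ≡ card G U
    card-cong S U = count-cong S U (allFin n)

    card-∨ : ∀ S U → (∀ a → S a ∧ U a ≡ false) → card G (λ a → S a ∨ U a) ≡ card G S + card G U
    card-∨ S U = count-∨ S U (allFin n)

    card-empty : ∀ S → (∀ a → S a ≡ false) → card G S ≡ 0
    card-empty S = count-empty S (allFin n)

    card-singleton : ∀ b → card G (singleton b) ≡ 1
    card-singleton b = count-singleton b (allFin n) (Unique.allFin⁺ n) (∈-allFin b)

    card≡0⊎inhabited : ∀ S → card G S ≡ 0 ⊎ ∃ λ a → S a ≡ true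
    card≡0⊎inhabited S with any? (λ a → S a Bool.≟ true)
    ... | yes found = inj₂ found
    ... | no none   = inj₁ (card-empty S absent)
      where
      absent : ∀ a → S a ≡ false
      absent a with S a in Sa
      ... | true  = ⊥-elim (none (a , Sa))
      ... | false = refl

    card-≤ : ∀ S U (f : Fin n → Fin n) → (∀ a → S a ≡ true → U (f a) ≡ true)
           → (∀ a b → S a ≡ true → S b ≡ true → f a ≡ f b → a ≡ b) → card G S ≤ card G U
    card-≤ S U f f∈U f-inj = injective⇒≤ {f = g} g-injective
      where
      Ss = filterᵇ S (allFin n)
      Us = filterᵇ U (allFin n)
      inS : ∀ i → S (lookup Ss i) ≡ true
      inS i with S (lookup Ss i) | ∈-filter⁻ (T? ∘ S) {xs = allFin n} (∈-lookup i)
      ... | true | _ = refl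
      mapped : ∀ i → f (lookup Ss i) ∈ Us
      mapped i = ∈-filter⁺ (T? ∘ U) (∈-allFin _) (subst T (sym (f∈U _ (inS i))) _)
      g : Fin (length Ss) → Fin (length Us)
      g i = index (mapped i)
      g-injective : ∀ {i j} → g i ≡ g j → i ≡ j
      g-injective {i} {j} gi≡gj = lookup-injective Ss (Unique.filter⁺ (T? ∘ S) (Unique.allFin⁺ n)) i j
        (f-inj _ _ (inS i) (inS j)
          (trans (lookup-index (mapped i)) (trans (cong (lookup Us) gi≡gj) (sym (lookup-index (mapped j))))))

    card-split : ∀ (S U : Fin n → Bool) → card G S ≡ card G (λ a → S a ∧ not (U a)) + card G (λ a → S a ∧ U a)
    card-split S U = trans (card-cong S _ split) (card-∨ _ _ disjoint)
      where
      split : ∀ a → S a ≡ (S a ∧ not (U a)) ∨ (S a ∧ U a)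
      split a with S a | U a
      ... | true  | true  = refl
      ... | true  | false = refl
      ... | false | _     = refl
      disjoint : ∀ a → (S a ∧ not (U a)) ∧ (S a ∧ U a) ≡ false
      disjoint a with S a | U a
      ... | true  | true  = refl
      ... | true  | false = refl
      ... | false | _     = refl

module _ (P : ℕ → Set) (P? : ∀ k → Dec (P k)) where

  private
    search : ∀ m → (∃ λ k → P k × (∀ j → j < k → ¬ P j)) ⊎ (∀ j → j < m → ¬ P j)
    search zero = inj₂ (λ _ ())
    search (suc m) with search m
    ... | inj₁ found = inj₁ found
    ... | inj₂ none with P? m
    ...   | yes Pm = inj₁ (m , Pm , none)
    ...   | no ¬Pm = inj₂ λ j j<1+m → case m≤n⇒m<n∨m≡n (≤-pred j<1+m) of λ where
                       (inj₁ j<m)  → none j j<m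
                       (inj₂ refl) → ¬Pm

  minimal-witness : ∀ m → P m → ∃ λ k → P k × (∀ j → j < k → ¬ P j)
  minimal-witness m Pm with search (suc m)
  ... | inj₁ found = found
  ... | inj₂ none  = ⊥-elim (none m ≤-refl Pm)

module Lagrange {n : ℕ} (G : FinGroup n) where
  open FinGroup G
  open GroupProperties (toGroup G)
  open Powers G
  open CyclicSubgroups G
  open Counting
  open ≡-Reasoning

  private
    positive-period? : ∀ x k → Dec (0 < k × pow G x k ≡ ε)
    positive-period? x zero    = no λ ()
    positive-period? x (suc k) = map′ (s≤s z≤n ,_) proj₂ (pow G x (suc k) ≟ ε)

  order : ∀ x → ∃ λ o → pow G x (suc o) ≡ ε × (∀ j → 0 < j → j < suc o → pow G x j ≢ ε)
  order x with period x
  ... | o , _ , xᵒ≡ε with minimal-witness _ (positive-period? x) (suc o) (s≤s z≤n , xᵒ≡ε)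
  ... | zero  , (() , _) , _
  ... | suc k , (_ , xᵏ≡ε) , below = k , xᵏ≡ε , λ j 0<j j<k xʲ≡ε → below j j<k (0<j , xʲ≡ε)

  module Orbit (x g : Fin n) where

    orbit : ℕ → Fin n → Bool
    orbit zero    a = false
    orbit (suc m) a = orbit m a ∨ singleton (pow G x m ∙ g) a

    orbit⁻ : ∀ m a → orbit m a ≡ true → ∃ λ i → i < m × a ≡ pow G x i ∙ g
    orbit⁻ (suc m) a a∈ with orbit m a in a∈′
    ... | true = let (i , i<m , a≡) = orbit⁻ m a a∈′ in i , m<n⇒m<1+n i<m , a≡
    ... | false with a ≟ pow G x m ∙ g
    ...   | yes a≡ = m , ≤-refl , a≡

    orbit⁺ : ∀ m i → i < m → orbit m (pow G x i ∙ g) ≡ true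
    orbit⁺ (suc m) i i<1+m with m≤n⇒m<n∨m≡n (≤-pred i<1+m)
    ... | inj₁ i<m  = cong (_∨ singleton (pow G x m ∙ g) (pow G x i ∙ g)) (orbit⁺ m i i<m)
    ... | inj₂ refl = trans (cong (orbit i (pow G x i ∙ g) ∨_) (dec-true (pow G x i ∙ g ≟ pow G x i ∙ g) refl))
                            (∨-zeroʳ _)

    module _ (o : ℕ) (xᵒ≡ε : pow G x (suc o) ≡ ε) (minimal : ∀ j → 0 < j → j < suc o → pow G x j ≢ ε) where

      orbit-distinct : ∀ i j → i < j → j < suc o → pow G x i ∙ g ≢ pow G x j ∙ g
      orbit-distinct i j i<j j≤o xⁱg≡xʲg = minimal (j ∸ i) (m<n⇒0<n∸m i<j) (≤-<-trans (m∸n≤m j i) j≤o)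
        (∙-cancelʳ (pow G x i) _ _ (begin
          pow G x (j ∸ i) ∙ pow G x i  ≡⟨ sym (pow-+ x (j ∸ i) i) ⟩
          pow G x (j ∸ i + i)          ≡⟨ cong (pow G x) (m∸n+n≡m (<⇒≤ i<j)) ⟩
          pow G x j                    ≡⟨ sym (∙-cancelʳ g _ _ xⁱg≡xʲg) ⟩
          pow G x i                    ≡⟨ sym (idˡ _) ⟩
          ε ∙ pow G x i                ∎))

      card-orbit : ∀ m → m ≤ suc o → card G (orbit m) ≡ m
      card-orbit zero    _   = card-empty G (orbit zero) (λ _ → refl)
      card-orbit (suc m) m≤o = begin
        card G (orbit (suc m))                                            ≡⟨ card-∨ G (orbit m) _ disjoint ⟩
        card G (orbit m) + card G (singleton (pow G x m ∙ g))             ≡⟨ cong₂ _+_ (card-orbit m (<⇒≤ m≤o)) (card-singleton G _) ⟩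
        m + 1                                                             ≡⟨ +-comm m 1 ⟩
        suc m                                                             ∎
        where
        disjoint : ∀ a → orbit m a ∧ singleton (pow G x m ∙ g) a ≡ false
        disjoint a with orbit m a in a∈
        ... | false = refl
        ... | true with a ≟ pow G x m ∙ g
        ...   | no _   = refl
        ...   | yes a≡ = let (i , i<m , a≡′) = orbit⁻ m a a∈ in ⊥-elim (orbit-distinct i m i<m m≤o (trans (sym a≡′) a≡))

      orbit-closed⁻ : ∀ a → orbit (suc o) (x ∙ a) ≡ true → orbit (suc o) a ≡ true
      orbit-closed⁻ a xa∈ with orbit⁻ (suc o) (x ∙ a) xa∈
      ... | zero , _ , xa≡g = subst (λ b → orbit (suc o) b ≡ true) (sym a≡xᵒg) (orbit⁺ (suc o) o ≤-refl)
        where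
        a≡xᵒg : a ≡ pow G x o ∙ g
        a≡xᵒg = ∙-cancelˡ x _ _ (begin
          x ∙ a                ≡⟨ xa≡g ⟩
          ε ∙ g                ≡⟨ cong (_∙ g) (sym xᵒ≡ε) ⟩
          (x ∙ pow G x o) ∙ g  ≡⟨ assoc _ _ _ ⟩
          x ∙ (pow G x o ∙ g)  ∎)
      ... | suc i , i<o , xa≡ = subst (λ b → orbit (suc o) b ≡ true) (sym (∙-cancelˡ x _ _ (trans xa≡ (assoc _ _ _))))
                                      (orbit⁺ (suc o) i (<-trans (n<1+n i) i<o))

  -- counting argument: S splits into S ∖ ⟨x⟩g and the coset ⟨x⟩g ⊆ S of size o + 1
  order∣card : ∀ x o → pow G x (suc o) ≡ ε → (∀ j → 0 < j → j < suc o → pow G x j ≢ ε)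
             → ∀ fuel S → card G S ≤ fuel → (∀ a → S a ≡ true → S (x ∙ a) ≡ true) → suc o ∣ card G S
  order∣card x o xᵒ≡ε minimal zero S ∣S∣≤0 _ = subst (suc o ∣_) (sym (n≤0⇒n≡0 ∣S∣≤0)) (suc o ∣0)
  order∣card x o xᵒ≡ε minimal (suc fuel) S ∣S∣≤ closed with card≡0⊎inhabited G S
  ... | inj₁ ∣S∣≡0    = subst (suc o ∣_) (sym ∣S∣≡0) (suc o ∣0)
  ... | inj₂ (g , Sg) = subst (suc o ∣_) (sym ∣S∣≡) (∣m∣n⇒∣m+n (order∣card x o xᵒ≡ε minimal fuel S′ bound closed′) ∣-refl)
    where
    open Orbit x g
    coset : Fin n → Bool
    coset = orbit (suc o)

    S′ : Fin n → Bool
    S′ a = S a ∧ not (coset a)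

    coset⊆S : ∀ a → coset a ≡ true → S a ≡ true
    coset⊆S a a∈ with orbit⁻ (suc o) a a∈
    ... | i , _ , refl = xⁱg∈S i
      where
      xⁱg∈S : ∀ i → S (pow G x i ∙ g) ≡ true
      xⁱg∈S zero    = subst (λ b → S b ≡ true) (sym (idˡ g)) Sg
      xⁱg∈S (suc i) = subst (λ b → S b ≡ true) (sym (assoc _ _ _)) (closed _ (xⁱg∈S i))

    S∧coset≗coset : ∀ a → S a ∧ coset a ≡ coset a
    S∧coset≗coset a with coset a in a∈
    ... | true  = cong (_∧ true) (coset⊆S a a∈)
    ... | false = ∧-zeroʳ (S a)

    ∣S∣≡ : card G S ≡ card G S′ + suc o
    ∣S∣≡ = trans (card-split G S coset)
                 (cong (card G S′ +_) (trans (card-cong G _ coset S∧coset≗coset) (card-orbit o xᵒ≡ε minimal (suc o) ≤-refl)))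

    bound : card G S′ ≤ fuel
    bound = m+n≤o⇒m≤o (card G S′) (≤-pred (subst (_≤ suc fuel) (trans ∣S∣≡ (+-suc _ o)) ∣S∣≤))

    closed′ : ∀ a → S′ a ≡ true → S′ (x ∙ a) ≡ true
    closed′ a S′a with S a in Sa | coset a in a∈ | coset (x ∙ a) in xa∈
    ... | true | false | false rewrite closed a Sa = refl
    ... | true | false | true  = case trans (sym (orbit-closed⁻ o xᵒ≡ε minimal a xa∈)) a∈ of λ ()

  lagrange : ∀ H → IsSubgroup G H → ∀ x → H x ≡ true → pow G x (card G H) ≡ ε
  lagrange H (_ , H-∙ , _) x Hx with order x
  ... | o , xᵒ≡ε , minimal with order∣card x o xᵒ≡ε minimal (card G H) H ≤-refl (λ a Ha → H-∙ x a Hx Ha)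
  ... | divides q ∣H∣≡ = trans (cong (pow G x) ∣H∣≡) (pow-multiple x (suc o) q xᵒ≡ε)

module NilpotentGroups {n : ℕ} (G : FinGroup n) where
  open FinGroup G
  open GroupProperties (toGroup G)
  open Powers G
  open GroupWords G

  private
    x₀ : ∀ {k} → Word (suc k)
    x₀ = var fzero
    x₁ : ∀ {k} → Word (suc (suc k))
    x₁ = var (fsuc fzero)
    x₂ : ∀ {k} → Word (suc (suc (suc k)))
    x₂ = var (fsuc (fsuc fzero))
    x₃ : ∀ {k} → Word (suc (suc (suc (suc k))))
    x₃ = var (fsuc (fsuc (fsuc fzero)))

    [_,_]ʷ : ∀ {k} → Word k → Word k → Word k
    [ u , v ]ʷ = inv u · inv v · u · v

  record IsNormal (Z : Fin n → Set) : Set where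
    field
      ε∈    : Z ε
      ∙∈    : ∀ {a b} → Z a → Z b → Z (a ∙ b)
      ⁻¹∈   : ∀ {a} → Z a → Z (a ⁻¹)
      conj∈ : ∀ {a} → Z a → ∀ h → Z (h ⁻¹ ∙ a ∙ h)

    pow∈ : ∀ {a} → Z a → ∀ k → Z (pow G a k)
    pow∈ a∈ zero    = ε∈
    pow∈ a∈ (suc k) = ∙∈ a∈ (pow∈ a∈ k)

    cancel∈ : ∀ {c a b} → c ∙ a ≡ b → Z a → Z b → Z c
    cancel∈ {c} {a} {b} c∙a≡b a∈ b∈ = subst Z
      (trans (cong (_∙ a ⁻¹) (sym c∙a≡b)) (solve (Vec.lookup (c ∷ a ∷ [])) (x₀ · x₁ · inv x₁) x₀ refl))
      (∙∈ b∈ (⁻¹∈ a∈))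

    -- Bézout: c = (cᴬ)ᵘ (cᴮ)⁻ᵛ or c = (cᴮ)ᵛ (cᴬ)⁻ᵘ
    coprime-powers∈ : ∀ c A B → Coprime A B → Z (pow G c A) → Z (pow G c B) → Z c
    coprime-powers∈ c A B coprime cᴬ∈ cᴮ∈ with coprime-Bézout coprime
    ... | Bézout.+- u v 1+vB≡uA = cancel∈ (cong (pow G c) 1+vB≡uA)
      (subst Z (sym (pow-*ˡ c v B)) (pow∈ cᴮ∈ v)) (subst Z (sym (pow-*ˡ c u A)) (pow∈ cᴬ∈ u))
    ... | Bézout.-+ u v 1+uA≡vB = cancel∈ (cong (pow G c) 1+uA≡vB)
      (subst Z (sym (pow-*ˡ c u A)) (pow∈ cᴬ∈ u)) (subst Z (sym (pow-*ˡ c v B)) (pow∈ cᴮ∈ v))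

  upperCentral-normal : ∀ i → IsNormal (UpperCentral G i)
  upperCentral-normal zero = record
    { ε∈    = refl
    ; ∙∈    = λ { refl refl → idˡ ε }
    ; ⁻¹∈   = λ { refl → ε⁻¹≈ε }
    ; conj∈ = λ { refl h → solve (Vec.lookup (h ∷ [])) (inv x₀ · one · x₀) one refl } }
  upperCentral-normal (suc i) = record
    { ε∈    = λ h → subst (UpperCentral G i) (sym (solve (Vec.lookup (h ∷ [])) [ one , x₀ ]ʷ one refl)) ε∈
    ; ∙∈    = λ {a} {b} a∈ b∈ h → subst (UpperCentral G i)
        (sym (solve (Vec.lookup (a ∷ b ∷ h ∷ [])) [ x₀ · x₁ , x₂ ]ʷ ((inv x₁ · [ x₀ , x₂ ]ʷ · x₁) · [ x₁ , x₂ ]ʷ) refl))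
        (∙∈ (conj∈ (a∈ h) b) (b∈ h))
    ; ⁻¹∈   = λ {a} a∈ h → subst (UpperCentral G i)
        (sym (solve (Vec.lookup (a ∷ h ∷ [])) [ inv x₀ , x₁ ]ʷ (inv (inv x₀) · inv [ x₀ , x₁ ]ʷ · inv x₀) refl))
        (conj∈ (⁻¹∈ (a∈ h)) (a ⁻¹))
    ; conj∈ = λ {a} a∈ h k → subst (UpperCentral G i)
        (sym (solve (Vec.lookup (a ∷ h ∷ k ∷ [])) [ inv x₁ · x₀ · x₁ , x₂ ]ʷ (inv x₁ · [ x₀ , x₁ · x₂ · inv x₁ ]ʷ · x₁) refl))
        (conj∈ (a∈ (h ∙ k ∙ h ⁻¹)) h) }
    where open IsNormal (upperCentral-normal i)

  module _ (i : ℕ) where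
    open IsNormal (upperCentral-normal i)

    private
      Z : Fin n → Set
      Z = UpperCentral G i

    -- modulo Z i, the map m ↦ [xᵐ, y] is the homomorphism m ↦ [x, y]ᵐ
    comm-pow-mod : ∀ x y → UpperCentral G (suc i) (comm G x y) → ∀ m → Z (pow G (comm G x y) m ⁻¹ ∙ comm G (pow G x m) y)
    comm-pow-mod x y _ zero = subst Z (sym (solve (Vec.lookup (y ∷ [])) (inv one · [ one , x₀ ]ʷ) one refl)) ε∈
    comm-pow-mod x y [x,y]∈ (suc m) = subst Z
      (sym (solve (Vec.lookup (x ∷ y ∷ pow G (comm G x y) m ∷ pow G x m ∷ []))
        (inv ([ x₀ , x₁ ]ʷ · x₂) · [ x₀ · x₃ , x₁ ]ʷ)
        ((inv x₂ · [ [ x₀ , x₁ ]ʷ , x₃ ]ʷ · x₂) · (inv x₂ · [ x₃ , x₁ ]ʷ)) refl))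
      (∙∈ (conj∈ ([x,y]∈ (pow G x m)) (pow G (comm G x y) m)) (comm-pow-mod x y [x,y]∈ m))

    comm-pow∈ : ∀ x y A → pow G x A ≡ ε → UpperCentral G (suc i) (comm G x y) → Z (pow G (comm G x y) A)
    comm-pow∈ x y A xᴬ≡ε [x,y]∈ = subst Z (⁻¹-involutive _) (⁻¹∈ (subst Z cᴬ⁻¹ (comm-pow-mod x y [x,y]∈ A)))
      where
      cᴬ⁻¹ : pow G (comm G x y) A ⁻¹ ∙ comm G (pow G x A) y ≡ pow G (comm G x y) A ⁻¹
      cᴬ⁻¹ = trans (cong (λ u → pow G (comm G x y) A ⁻¹ ∙ comm G u y) xᴬ≡ε)
                   (solve (Vec.lookup (pow G (comm G x y) A ∷ y ∷ [])) (inv x₀ · [ one , x₁ ]ʷ) (inv x₀) refl)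

    comm∈ : ∀ x y A B → Coprime A B → pow G x A ≡ ε → pow G y B ≡ ε
          → UpperCentral G (suc i) (comm G x y) → UpperCentral G (suc i) (comm G y x) → Z (comm G x y)
    comm∈ x y A B coprime xᴬ≡ε yᴮ≡ε [x,y]∈ [y,x]∈ =
      coprime-powers∈ (comm G x y) A B coprime (comm-pow∈ x y A xᴬ≡ε [x,y]∈) [x,y]ᴮ∈
      where
      [y,x]ᴮ≡ : pow G (comm G y x) B ≡ pow G (comm G x y) B ⁻¹
      [y,x]ᴮ≡ = trans (cong (λ u → pow G u B) (solve (Vec.lookup (x ∷ y ∷ [])) [ x₁ , x₀ ]ʷ (inv [ x₀ , x₁ ]ʷ) refl))
                      (pow-⁻¹ (comm G x y) B)
      [x,y]ᴮ∈ : Z (pow G (comm G x y) B)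
      [x,y]ᴮ∈ = subst Z (⁻¹-involutive _) (⁻¹∈ (subst Z [y,x]ᴮ≡ (comm-pow∈ y x B yᴮ≡ε [y,x]∈)))

  -- descend the upper central series: [x, y] ∈ Z (c − d) for d = 0, 1, …, c
  coprime-orders-commute : Nilpotent G → ∀ A B → Coprime A B
                         → ∀ x y → pow G x A ≡ ε → pow G y B ≡ ε → x ∙ y ≡ y ∙ x
  coprime-orders-commute (c , Zc≡G) A B coprime x y xᴬ≡ε yᴮ≡ε =
    trans (sym (solve (Vec.lookup (x ∷ y ∷ [])) (x₁ · x₀ · [ x₀ , x₁ ]ʷ) (x₀ · x₁) refl))
          (trans (cong (y ∙ x ∙_) (proj₁ (descend c 0 (+-identityʳ c) x y xᴬ≡ε yᴮ≡ε))) (idʳ _))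
    where
    descend : ∀ d i → d + i ≡ c → ∀ x y → pow G x A ≡ ε → pow G y B ≡ ε
            → UpperCentral G i (comm G x y) × UpperCentral G i (comm G y x)
    descend zero    i refl x y _ _ = Zc≡G _ , Zc≡G _
    descend (suc d) i d+i≡c x y xᴬ≡ε yᴮ≡ε =
        comm∈ i x y A B coprime xᴬ≡ε yᴮ≡ε (proj₁ above) (proj₂ above)
      , comm∈ i y x B A (Coprime.sym coprime) yᴮ≡ε xᴬ≡ε (proj₂ above) (proj₁ above)
      where above = descend d (suc i) (trans (+-suc d i) d+i≡c) x y xᴬ≡ε yᴮ≡ε

prime∤⇒coprime : ∀ {p m} → Prime p → ¬ p ∣ m → Coprime p m
prime∤⇒coprime p-prime p∤m (d∣p , d∣m) with prime⇒irreducible p-prime d∣p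
... | inj₁ d≡1  = d≡1
... | inj₂ refl = ⊥-elim (p∤m d∣m)

distinct-primes⇒coprime : ∀ {p q} → Prime p → Prime q → p ≢ q → Coprime p q
distinct-primes⇒coprime p-prime q-prime p≢q = prime∤⇒coprime p-prime λ p∣q →
  case prime⇒irreducible q-prime p∣q of λ where
    (inj₁ p≡1) → ¬prime[1] (subst Prime p≡1 p-prime)
    (inj₂ p≡q) → p≢q p≡q

coprime-*ˡ : ∀ {a b c} → Coprime a c → Coprime b c → Coprime (a * b) c
coprime-*ˡ {a} a⊥c b⊥c (d∣ab , d∣c) = b⊥c (coprime-divisor d⊥a d∣ab , d∣c)
  where
  d⊥a : Coprime _ a
  d⊥a (e∣d , e∣a) = a⊥c (e∣a , ∣-trans e∣d d∣c)

coprime-^ˡ : ∀ {a c} k → Coprime a c → Coprime (a ^ k) c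
coprime-^ˡ zero    _   = 1-coprimeTo _
coprime-^ˡ (suc k) a⊥c = coprime-*ˡ a⊥c (coprime-^ˡ k a⊥c)

coprime-^ : ∀ {a b} k l → Coprime a b → Coprime (a ^ k) (b ^ l)
coprime-^ k l a⊥b = coprime-^ˡ k (Coprime.sym (coprime-^ˡ l (Coprime.sym a⊥b)))

coprime-prodℕ : ∀ {r c} (f : Fin r → ℕ) → (∀ i → Coprime (f i) c) → Coprime (prodℕ f) c
coprime-prodℕ {zero}  f _      = 1-coprimeTo _
coprime-prodℕ {suc r} f fᵢ⊥c = coprime-*ˡ (fᵢ⊥c fzero) (coprime-prodℕ (f ∘ fsuc) (fᵢ⊥c ∘ fsuc))

∣prodℕ : ∀ {r} (f : Fin r → ℕ) i → f i ∣ prodℕ f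
∣prodℕ f fzero    = m∣m*n _
∣prodℕ f (fsuc i) = ∣-trans (∣prodℕ (f ∘ fsuc) i) (n∣m*n (f fzero))

cofactor : ∀ {r} → (Fin r → ℕ) → Fin r → ℕ
cofactor M j = prodℕ (λ i → if does (i ≟ j) then 1 else M i)

∣cofactor : ∀ {r} (M : Fin r → ℕ) {i j} → i ≢ j → M i ∣ cofactor M j
∣cofactor M {i} {j} i≢j with ∣prodℕ (λ i → if does (i ≟ j) then 1 else M i) i
... | Mᵢ∣ with i ≟ j
...   | no _    = Mᵢ∣
...   | yes i≡j = ⊥-elim (i≢j i≡j)

cofactor-coprime : ∀ {r} (M : Fin r → ℕ) j → (∀ i → i ≢ j → Coprime (M i) (M j)) → Coprime (cofactor M j) (M j)
cofactor-coprime M j Mᵢ⊥Mⱼ = coprime-prodℕ _ factor⊥Mⱼ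
  where
  factor⊥Mⱼ : ∀ i → Coprime (if does (i ≟ j) then 1 else M i) (M j)
  factor⊥Mⱼ i with i ≟ j
  ... | yes _  = 1-coprimeTo _
  ... | no i≢j = Mᵢ⊥Mⱼ i i≢j

module CommutingProducts {n : ℕ} (G : FinGroup n) where
  open FinGroup G
  open GroupProperties (toGroup G)
  open Powers G
  open ≡-Reasoning

  PairwiseCommuting : ∀ {r} → (Fin r → Fin n) → Set
  PairwiseCommuting f = ∀ i j → i ≢ j → Commute (f i) (f j)

  prodG-ε : ∀ {r} (f : Fin r → Fin n) → (∀ i → f i ≡ ε) → prodG G f ≡ ε
  prodG-ε {zero}  f _   = refl
  prodG-ε {suc r} f f≗ε = trans (cong₂ _∙_ (f≗ε fzero) (prodG-ε (f ∘ fsuc) (f≗ε ∘ fsuc))) (idˡ ε)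

  prodG-single : ∀ {r} (f : Fin r → Fin n) j → (∀ i → i ≢ j → f i ≡ ε) → prodG G f ≡ f j
  prodG-single f fzero    others = trans (cong (f fzero ∙_) (prodG-ε (f ∘ fsuc) (λ i → others (fsuc i) λ ()))) (idʳ _)
  prodG-single f (fsuc j) others =
    trans (cong₂ _∙_ (others fzero λ ()) (prodG-single (f ∘ fsuc) j (λ i i≢j → others (fsuc i) (i≢j ∘ suc-injective))))
          (idˡ _)

  commute-prodG : ∀ {r} a (f : Fin r → Fin n) → (∀ i → Commute a (f i)) → Commute a (prodG G f)
  commute-prodG {zero}  a f _   = commute-ε a
  commute-prodG {suc r} a f a↔f = commute-∙ (a↔f fzero) (commute-prodG a (f ∘ fsuc) (a↔f ∘ fsuc))

  pow-prodG : ∀ {r} (f : Fin r → Fin n) → PairwiseCommuting f → ∀ k → pow G (prodG G f) k ≡ prodG G (λ i → pow G (f i) k)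
  pow-prodG {zero}  f _   k = pow-ε k
  pow-prodG {suc r} f f↔f k = trans (pow-∙ (commute-prodG (f fzero) _ (λ i → f↔f fzero (fsuc i) λ ())) k)
    (cong (pow G (f fzero) k ∙_) (pow-prodG (f ∘ fsuc) (λ i j i≢j → f↔f (fsuc i) (fsuc j) (i≢j ∘ suc-injective)) k))

  prodG-updateAt : ∀ {r} (f : Fin r → Fin n) k z → (∀ i → i ≢ k → Commute z (f i))
                 → prodG G f ∙ z ≡ prodG G (updateAt f k (_∙ z))
  prodG-updateAt f fzero z z↔f = begin
    f fzero ∙ prodG G (f ∘ fsuc) ∙ z    ≡⟨ assoc _ _ _ ⟩
    f fzero ∙ (prodG G (f ∘ fsuc) ∙ z)  ≡⟨ cong (f fzero ∙_) (sym (commute-prodG z (f ∘ fsuc) (λ i → z↔f (fsuc i) λ ()))) ⟩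
    f fzero ∙ (z ∙ prodG G (f ∘ fsuc))  ≡⟨ sym (assoc _ _ _) ⟩
    f fzero ∙ z ∙ prodG G (f ∘ fsuc)    ∎
  prodG-updateAt f (fsuc k) z z↔f = trans (assoc _ _ _)
    (cong (f fzero ∙_) (prodG-updateAt (f ∘ fsuc) k z (λ i i≢k → z↔f (fsuc i) (i≢k ∘ suc-injective))))

  record IsProjector {r} (M : Fin r → ℕ) (j : Fin r) (C : ℕ) : Set where
    field
      kills : ∀ i → i ≢ j → M i ∣ C
      fixes : ∀ g → pow G g (M j) ≡ ε → pow G g C ≡ g

  -- by Bézout, 1 + x M ≡ y N or 1 + y N ≡ x M; in the second case g^(y N) = g⁻¹, so C = (y N)² works
  idempotent-exponent : ∀ M N → Coprime M N → ∃ λ C → N ∣ C × (∀ g → pow G g M ≡ ε → pow G g C ≡ g)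
  idempotent-exponent M N M⊥N with coprime-Bézout M⊥N
  ... | Bézout.-+ x y 1+xM≡yN = y * N , divides y refl , λ g gᴹ≡ε → begin
    pow G g (y * N)        ≡⟨ cong (pow G g) (sym 1+xM≡yN) ⟩
    g ∙ pow G g (x * M)    ≡⟨ cong (g ∙_) (pow-multiple g M x gᴹ≡ε) ⟩
    g ∙ ε                  ≡⟨ idʳ g ⟩
    g                      ∎
  ... | Bézout.+- x y 1+yN≡xM = y * N * (y * N) , divides (y * N * y) (sym (*-assoc (y * N) y N)) , λ g gᴹ≡ε →
    let gʸᴺ≡g⁻¹ : pow G g (y * N) ≡ g ⁻¹
        gʸᴺ≡g⁻¹ = inverseʳ-unique g _ (trans (cong (pow G g) 1+yN≡xM) (pow-multiple g M x gᴹ≡ε))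
    in begin
    pow G g (y * N * (y * N))        ≡⟨ pow-*ˡ g (y * N) (y * N) ⟩
    pow G (pow G g (y * N)) (y * N)  ≡⟨ cong (λ u → pow G u (y * N)) gʸᴺ≡g⁻¹ ⟩
    pow G (g ⁻¹) (y * N)             ≡⟨ pow-⁻¹ g (y * N) ⟩
    pow G g (y * N) ⁻¹               ≡⟨ cong _⁻¹ gʸᴺ≡g⁻¹ ⟩
    g ⁻¹ ⁻¹                          ≡⟨ ⁻¹-involutive g ⟩
    g                                ∎

  InCyc-pow-coprime : ∀ g m s → Coprime m s → pow G g m ≡ ε → InCyc G (pow G g s) g
  InCyc-pow-coprime g m s m⊥s gᵐ≡ε with idempotent-exponent m s m⊥s
  ... | C , divides q refl , fixes = q , trans (sym (fixes g gᵐ≡ε)) (pow-*ˡ g q s)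

  projector : ∀ {r} (M : Fin r → ℕ) → (∀ i j → i ≢ j → Coprime (M i) (M j)) → ∀ j → ∃ (IsProjector M j)
  projector M M⊥M j with idempotent-exponent (M j) (cofactor M j) (Coprime.sym (cofactor-coprime M j (λ i → M⊥M i j)))
  ... | C , cofactor∣C , fixes = C , record { kills = λ i i≢j → ∣-trans (∣cofactor M i≢j) cofactor∣C ; fixes = fixes }

  project : ∀ {r} (M : Fin r → ℕ) (f : Fin r → Fin n) → PairwiseCommuting f → (∀ i → pow G (f i) (M i) ≡ ε)
          → ∀ {j C} → IsProjector M j C → pow G (prodG G f) C ≡ f j
  project M f f↔f fᴹ≡ε {j} {C} C-projects =
    trans (pow-prodG f f↔f C) (trans (prodG-single _ j killed) (fixes (f j) (fᴹ≡ε j)))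
    where
    open IsProjector C-projects
    killed : ∀ i → i ≢ j → pow G (f i) C ≡ ε
    killed i i≢j with kills i i≢j
    ... | divides q refl = pow-multiple (f i) (M i) q (fᴹ≡ε i)

module PowerGraph {n : ℕ} (G : FinGroup n) where
  open FinGroup G
  open GroupProperties (toGroup G)
  open Powers G
  open CyclicSubgroups G
  open Counting

  cyclic : Fin n → Fin n → Bool
  cyclic y a = ⌊ InCyc? y a ⌋

  cyclic⇒InCyc : ∀ y a → cyclic y a ≡ true → InCyc G y a
  cyclic⇒InCyc y a = toWitness ∘ Equivalence.from T-≡

  InCyc⇒cyclic : ∀ y a → InCyc G y a → cyclic y a ≡ true
  InCyc⇒cyclic y a = Equivalence.to T-≡ ∘ fromWitness

  adjacent-power : ∀ x b → x ≢ b → InCyc G x b → adj G x b ≡ true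
  adjacent-power x b x≢b b∈⟨x⟩ with x ≟ b
  ... | yes x≡b = ⊥-elim (x≢b x≡b)
  ... | no _ rewrite InCyc⇒isPosPowerOf b x b∈⟨x⟩ = refl

  adjacent-root : ∀ x b → x ≢ b → InCyc G b x → adj G x b ≡ true
  adjacent-root x b x≢b x∈⟨b⟩ with x ≟ b
  ... | yes x≡b = ⊥-elim (x≢b x≡b)
  ... | no _ rewrite InCyc⇒isPosPowerOf x b x∈⟨b⟩ = ∨-zeroʳ _

  adjacent⇒InCyc : ∀ x b → adj G x b ≡ true → InCyc G x b ⊎ InCyc G b x
  adjacent⇒InCyc x b x~b with x ≟ b
  ... | no _ with isPosPowerOf G b x in b∈⟨x⟩
  ...   | true  = inj₁ (isPosPowerOf⇒InCyc b x b∈⟨x⟩)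
  ...   | false = inj₂ (isPosPowerOf⇒InCyc x b x~b)

  adj-irreflexive : ∀ x → adj G x x ≡ false
  adj-irreflexive x rewrite dec-true (x ≟ x) refl = refl

  maximal-adj⇒InCyc : ∀ y → MaxCyclic G y → ∀ a → adj G y a ≡ true → InCyc G y a
  maximal-adj⇒InCyc y maximal a y~a with adjacent⇒InCyc y a y~a
  ... | inj₁ a∈⟨y⟩ = a∈⟨y⟩
  ... | inj₂ y∈⟨a⟩ = maximal a (λ _ → InCyc-trans y∈⟨a⟩) a (InCyc-refl a)

  -- the closed neighbourhood of a generator of a maximal cyclic subgroup lies in that subgroup
  deg<card-cyclic : ∀ y → MaxCyclic G y → deg G y < card G (cyclic y)
  deg<card-cyclic y maximal = subst (_≤ card G (cyclic y)) card-neighbourhood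
    (card-≤ G neighbourhood (cyclic y) id (λ a → InCyc⇒cyclic y a ∘ neighbourhood⊆ a) (λ _ _ _ _ → id))
    where
    neighbourhood : Fin n → Bool
    neighbourhood a = adj G y a ∨ singleton y a
    neighbourhood⊆ : ∀ a → neighbourhood a ≡ true → InCyc G y a
    neighbourhood⊆ a a∈ with adj G y a in y~a
    ... | true = maximal-adj⇒InCyc y maximal a y~a
    ... | false with a ≟ y
    ...   | yes refl = InCyc-refl y
    card-neighbourhood : card G neighbourhood ≡ suc (deg G y)
    card-neighbourhood = trans (card-∨ G (adj G y) (singleton y) disjoint)
                               (trans (cong (deg G y +_) (card-singleton G y)) (+-comm (deg G y) 1))
      where
      disjoint : ∀ a → adj G y a ∧ singleton y a ≡ false
      disjoint a with a ≟ y
      ... | yes refl = cong (_∧ true) (adj-irreflexive y)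
      ... | no _     = ∧-zeroʳ _

  card-cyclic≤ : ∀ y S (f : Fin n → Fin n) → (∀ a → InCyc G y a → S (f a) ≡ true)
               → (∀ a b → InCyc G y a → InCyc G y b → f a ≡ f b → a ≡ b) → card G (cyclic y) ≤ card G S
  card-cyclic≤ y S f f∈S f-injective = card-≤ G (cyclic y) S f (λ a → f∈S a ∘ cyclic⇒InCyc y a)
    (λ a b a∈ b∈ → f-injective a b (cyclic⇒InCyc y a a∈) (cyclic⇒InCyc y b b∈))

  module _ (y z : Fin n) (z∉⟨y⟩ : ¬ InCyc G y z) where

    private
      ε≢z : ε ≢ z
      ε≢z ε≡z = z∉⟨y⟩ (subst (InCyc G y) ε≡z (InCyc-ε y))

      ∙z∉ : ∀ {a b} → InCyc G y a → InCyc G y b → a ∙ z ≢ b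
      ∙z∉ a∈ b∈ a∙z≡b = z∉⟨y⟩ (InCyc-cancelˡ a∈ b∈ a∙z≡b)

    card-cyclic≤deg-ε : card G (cyclic y) ≤ deg G ε
    card-cyclic≤deg-ε = card-cyclic≤ y (adj G ε) f f-adj f-injective
      where
      f : Fin n → Fin n
      f a with a ≟ ε
      ... | yes _ = z
      ... | no _  = a
      f-adj : ∀ a → InCyc G y a → adj G ε (f a) ≡ true
      f-adj a _ with a ≟ ε
      ... | yes _   = adjacent-root ε z ε≢z (InCyc-ε z)
      ... | no a≢ε = adjacent-root ε a (a≢ε ∘ sym) (InCyc-ε a)
      f-injective : ∀ a b → InCyc G y a → InCyc G y b → f a ≡ f b → a ≡ b
      f-injective a b a∈ b∈ fa≡fb with a ≟ ε | b ≟ ε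
      ... | yes a≡ε | yes b≡ε = trans a≡ε (sym b≡ε)
      ... | yes _   | no _    = ⊥-elim (z∉⟨y⟩ (subst (InCyc G y) (sym fa≡fb) b∈))
      ... | no _    | yes _   = ⊥-elim (z∉⟨y⟩ (subst (InCyc G y) fa≡fb a∈))
      ... | no _    | no _    = fa≡fb

    -- ⟨y⟩ ↪ neighbours of x: x ↦ ε, roots of x stay, every other a ↦ a x z, of which x is a power
    card-cyclic≤deg : ∀ x → x ≢ ε → InCyc G y x → (∀ a → InCyc G y a → ¬ InCyc G a x → InCyc G (a ∙ x ∙ z) x)
                    → card G (cyclic y) ≤ deg G x
    card-cyclic≤deg x x≢ε x∈⟨y⟩ x∈⟨axz⟩ = card-cyclic≤ y (adj G x) f f-adj f-injective
      where
      ∈⟨ε⟩ : ∀ {b} → InCyc G ε b → b ≡ ε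
      ∈⟨ε⟩ (m , b≡) = trans b≡ (pow-ε m)
      f : Fin n → Fin n
      f a with a ≟ x | InCyc? a x
      ... | yes _ | _     = ε
      ... | no _  | yes _ = a
      ... | no _  | no _  = a ∙ x ∙ z
      f-adj : ∀ a → InCyc G y a → adj G x (f a) ≡ true
      f-adj a a∈ with a ≟ x | InCyc? a x
      ... | yes _   | _         = adjacent-power x ε x≢ε (InCyc-ε x)
      ... | no a≢x | yes x∈⟨a⟩ = adjacent-root x a (a≢x ∘ sym) x∈⟨a⟩
      ... | no _    | no x∉⟨a⟩  = adjacent-root x (a ∙ x ∙ z)
            (λ x≡axz → ∙z∉ (InCyc-∙ a∈ x∈⟨y⟩) x∈⟨y⟩ (sym x≡axz))
            (x∈⟨axz⟩ a a∈ x∉⟨a⟩)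
      f-injective : ∀ a b → InCyc G y a → InCyc G y b → f a ≡ f b → a ≡ b
      f-injective a b a∈ b∈ fa≡fb with a ≟ x | InCyc? a x | b ≟ x | InCyc? b x
      ... | yes a≡x | _ | yes b≡x | _     = trans a≡x (sym b≡x)
      ... | yes _ | _ | no _ | yes x∈⟨b⟩  = ⊥-elim (x≢ε (∈⟨ε⟩ (subst (λ c → InCyc G c x) (sym fa≡fb) x∈⟨b⟩)))
      ... | yes _ | _ | no _ | no _       = ⊥-elim (∙z∉ (InCyc-∙ b∈ x∈⟨y⟩) (InCyc-ε y) (sym fa≡fb))
      ... | no _ | yes x∈⟨a⟩ | yes _ | _ = ⊥-elim (x≢ε (∈⟨ε⟩ (subst (λ c → InCyc G c x) fa≡fb x∈⟨a⟩)))
      ... | no _ | no _ | yes _ | _       = ⊥-elim (∙z∉ (InCyc-∙ a∈ x∈⟨y⟩) (InCyc-ε y) fa≡fb)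
      ... | no _ | yes _ | no _ | yes _   = fa≡fb
      ... | no _ | yes _ | no _ | no _    = ⊥-elim (∙z∉ (InCyc-∙ b∈ x∈⟨y⟩) a∈ (sym fa≡fb))
      ... | no _ | no _ | no _ | yes _    = ⊥-elim (∙z∉ (InCyc-∙ a∈ x∈⟨y⟩) b∈ fa≡fb)
      ... | no _ | no _ | no _ | no _     = ∙-cancelʳ x a b (∙-cancelʳ z _ _ fa≡fb)

module PowerGraphOfNilpotentGroup
  {n r : ℕ} (G : FinGroup n) (nilpotent : Nilpotent G)
  (p α : Fin r → ℕ) (p-prime : ∀ i → Prime (p i)) (p-increasing : ∀ i j → i <ᶠ j → p i < p j)
  (P : Fin r → Fin n → Bool) (sylow : ∀ i → IsSylow G (p i) (α i) (P i))
  (y : Fin n) (ys : Fin r → Fin n) (ys∈P : ∀ i → P i (ys i) ≡ true) (y≡∏ys : y ≡ prodG G ys)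
  where
  open FinGroup G
  open Powers G
  open CyclicSubgroups G
  open Lagrange G using (lagrange)
  open NilpotentGroups G using (coprime-orders-commute)
  open CommutingProducts G
  open PowerGraph G
  open ≡-Reasoning

  M : Fin r → ℕ
  M i = p i ^ α i

  P-∙ : ∀ i a b → P i a ≡ true → P i b ≡ true → P i (a ∙ b) ≡ true
  P-∙ i = proj₁ (proj₂ (proj₁ (sylow i)))

  P-pow : ∀ i a → P i a ≡ true → ∀ k → P i (pow G a k) ≡ true
  P-pow i a a∈ zero    = proj₁ (proj₁ (sylow i))
  P-pow i a a∈ (suc k) = P-∙ i a _ a∈ (P-pow i a a∈ k)

  P-exponent : ∀ i a → P i a ≡ true → pow G a (M i) ≡ ε
  P-exponent i a a∈ = subst (λ m → pow G a m ≡ ε) (proj₂ (sylow i)) (lagrange (P i) (proj₁ (sylow i)) a a∈)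

  M-coprime : ∀ i j → i ≢ j → Coprime (M i) (M j)
  M-coprime i j i≢j = coprime-^ (α i) (α j) (distinct-primes⇒coprime (p-prime i) (p-prime j) pᵢ≢pⱼ)
    where
    pᵢ≢pⱼ : p i ≢ p j
    pᵢ≢pⱼ with <-cmpᶠ i j
    ... | tri< i<j _ _ = <⇒≢ (p-increasing i j i<j)
    ... | tri≈ _ i≡j _ = ⊥-elim (i≢j i≡j)
    ... | tri> _ _ j<i = ≢-sym (<⇒≢ (p-increasing j i j<i))

  sylows-commute : ∀ i j → i ≢ j → ∀ a b → P i a ≡ true → P j b ≡ true → Commute a b
  sylows-commute i j i≢j a b a∈ b∈ =
    coprime-orders-commute nilpotent (M i) (M j) (M-coprime i j i≢j) a b (P-exponent i a a∈) (P-exponent j b b∈)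

  commuting-components : ∀ f → (∀ i → P i (f i) ≡ true) → PairwiseCommuting f
  commuting-components f f∈P i j i≢j = sylows-commute i j i≢j _ _ (f∈P i) (f∈P j)

  C : Fin r → ℕ
  C j = proj₁ (projector M M-coprime j)

  C-projects : ∀ j → IsProjector M j (C j)
  C-projects j = proj₂ (projector M M-coprime j)

  project-components : ∀ f → (∀ i → P i (f i) ≡ true) → ∀ j → pow G (prodG G f) (C j) ≡ f j
  project-components f f∈P j = project M f (commuting-components f f∈P) (λ i → P-exponent i _ (f∈P i)) (C-projects j)

  yᶜ≡ys : ∀ j → pow G y (C j) ≡ ys j
  yᶜ≡ys j = trans (cong (λ u → pow G u (C j)) y≡∏ys) (project-components ys ys∈P j)

  ys∈⟨y⟩ : ∀ j → InCyc G y (ys j)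
  ys∈⟨y⟩ j = C j , sym (yᶜ≡ys j)

  -- if P k ⊆ ⟨y⟩ then projecting to the k-th component gives P k = ⟨ys k⟩
  noncyclic⇒⊈⟨y⟩ : ∀ k → ¬ CyclicSub G (P k) → ∃ λ z → P k z ≡ true × ¬ InCyc G y z
  noncyclic⇒⊈⟨y⟩ k noncyclic with any? (λ z → (P k z Bool.≟ true) ×-dec ¬? (InCyc? y z))
  ... | yes outside = outside
  ... | no  none    = ⊥-elim (noncyclic (ys k , ys∈P k , generated))
    where
    generated : ∀ h → P k h ≡ true → InCyc G (ys k) h
    generated h h∈ with InCyc? y h
    ... | no h∉⟨y⟩       = ⊥-elim (none (h , h∈ , h∉⟨y⟩))
    ... | yes (s , h≡yˢ) = s , (begin
      h                        ≡⟨ sym (IsProjector.fixes (C-projects k) h (P-exponent k h h∈)) ⟩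
      pow G h (C k)            ≡⟨ cong (λ u → pow G u (C k)) h≡yˢ ⟩
      pow G (pow G y s) (C k)  ≡⟨ pow-pow-comm y s (C k) ⟩
      pow G (pow G y (C k)) s  ≡⟨ cong (λ u → pow G u s) (yᶜ≡ys k) ⟩
      pow G (ys k) s           ∎)

  module _ (k : Fin r) (z : Fin n) (z∈Pₖ : P k z ≡ true) (j : Fin r) (j≢k : j ≢ k) where

    -- for a = yᵗ, (a yⱼ z)^(C j) = yⱼ^(t+1); and yⱼ ∉ ⟨a⟩ forces p j ∣ t, so yⱼ^(t+1) generates ⟨yⱼ⟩
    ys∈⟨a∙ys∙z⟩ : ∀ a → InCyc G y a → ¬ InCyc G a (ys j) → InCyc G (a ∙ ys j ∙ z) (ys j)
    ys∈⟨a∙ys∙z⟩ a (t , refl) yⱼ∉⟨a⟩ = InCyc-trans (C j , sym projection) (generates (suc t) p∤1+t)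
      where
      generates : ∀ s → ¬ p j ∣ s → InCyc G (pow G (ys j) s) (ys j)
      generates s p∤s = InCyc-pow-coprime (ys j) (M j) s (coprime-^ˡ (α j) (prime∤⇒coprime (p-prime j) p∤s))
                                          (P-exponent j _ (ys∈P j))

      p∣t : p j ∣ t
      p∣t with p j ∣? t
      ... | yes p∣t = p∣t
      ... | no  p∤t = ⊥-elim (yⱼ∉⟨a⟩ (InCyc-trans (C j , yⱼᵗ≡) (generates t p∤t)))
        where
        yⱼᵗ≡ : pow G (ys j) t ≡ pow G (pow G y t) (C j)
        yⱼᵗ≡ = trans (cong (λ u → pow G u t) (sym (yᶜ≡ys j))) (pow-pow-comm y (C j) t)

      p∤1+t : ¬ p j ∣ suc t
      p∤1+t p∣1+t = ¬prime[1] (subst Prime (∣1⇒≡1 (∣m+n∣m⇒∣n (subst (p j ∣_) (+-comm 1 t) p∣1+t) p∣t)) (p-prime j))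

      s : ℕ
      s = t + C j

      components : Fin r → Fin n
      components = updateAt (λ i → pow G (ys i) s) k (_∙ z)

      components∈P : ∀ i → P i (components i) ≡ true
      components∈P i with i ≟ k
      ... | yes refl = subst (λ b → P k b ≡ true) (sym (updateAt-updates k _))
                             (P-∙ k _ z (P-pow k _ (ys∈P k) s) z∈Pₖ)
      ... | no  i≢k = subst (λ b → P i b ≡ true) (sym (updateAt-minimal i k _ i≢k)) (P-pow i _ (ys∈P i) s)

      z↔components : ∀ i → i ≢ k → Commute z (pow G (ys i) s)
      z↔components i i≢k = sylows-commute k i (≢-sym i≢k) z _ z∈Pₖ (P-pow i _ (ys∈P i) s)

      projection : pow G (pow G y t ∙ ys j ∙ z) (C j) ≡ pow G (ys j) (suc t)
      projection = begin
        pow G (pow G y t ∙ ys j ∙ z) (C j)                  ≡⟨ cong (λ u → pow G (pow G y t ∙ u ∙ z) (C j)) (sym (yᶜ≡ys j)) ⟩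
        pow G (pow G y t ∙ pow G y (C j) ∙ z) (C j)         ≡⟨ cong (λ u → pow G (u ∙ z) (C j)) (sym (pow-+ y t (C j))) ⟩
        pow G (pow G y s ∙ z) (C j)                         ≡⟨ cong (λ u → pow G (pow G u s ∙ z) (C j)) y≡∏ys ⟩
        pow G (pow G (prodG G ys) s ∙ z) (C j)              ≡⟨ cong (λ u → pow G (u ∙ z) (C j)) (pow-prodG ys (commuting-components ys ys∈P) s) ⟩
        pow G (prodG G (λ i → pow G (ys i) s) ∙ z) (C j)    ≡⟨ cong (λ u → pow G u (C j)) (prodG-updateAt _ k z z↔components) ⟩
        pow G (prodG G components) (C j)                    ≡⟨ project-components components components∈P j ⟩
        components j                                        ≡⟨ updateAt-minimal j k _ j≢k ⟩
        pow G (ys j) (t + C j)                              ≡⟨ pow-+ (ys j) t (C j) ⟩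
        pow G (ys j) t ∙ pow G (ys j) (C j)                 ≡⟨ cong (pow G (ys j) t ∙_) (IsProjector.fixes (C-projects j) (ys j) (P-exponent j _ (ys∈P j))) ⟩
        pow G (ys j) t ∙ ys j                               ≡⟨ sym (pow-sucʳ (ys j) t) ⟩
        pow G (ys j) (suc t)                                ∎

  deg<deg-component : MaxCyclic G y → ∀ k → ¬ CyclicSub G (P k) → ∀ j → j ≢ k → deg G y < deg G (ys j)
  deg<deg-component maximal k noncyclic j j≢k with noncyclic⇒⊈⟨y⟩ k noncyclic | ys j ≟ ε
  ... | z , z∈Pₖ , z∉⟨y⟩ | yes yⱼ≡ε = <-≤-trans (deg<card-cyclic y maximal)
    (subst (λ x → card G (cyclic y) ≤ deg G x) (sym yⱼ≡ε) (card-cyclic≤deg-ε y z z∉⟨y⟩))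
  ... | z , z∈Pₖ , z∉⟨y⟩ | no  yⱼ≢ε = <-≤-trans (deg<card-cyclic y maximal)
    (card-cyclic≤deg y z z∉⟨y⟩ (ys j) yⱼ≢ε (ys∈⟨y⟩ j) (ys∈⟨a∙ys∙z⟩ k z z∈Pₖ j j≢k))

corollary2p5 : ∀ {n r : ℕ} (G : FinGroup n) → Nilpotent G
    → (p α : Fin r → ℕ)
    → (∀ i → Prime (p i))
    → (∀ i j → i <ᶠ j → p i < p j)
    → (∀ i → 1 ≤ α i)
    → 2 ≤ r
    → n ≡ prodℕ (λ i → p i ^ α i)
    → (P : Fin r → Fin n → Bool)
    → (∀ i → IsSylow G (p i) (α i) (P i))
    → (y : Fin n) → MaxCyclic G y
    → (ys : Fin r → Fin n)
    → (∀ i → P i (ys i) ≡ true)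
    → y ≡ prodG G ys
    → (∀ k → ¬ CyclicSub G (P k) → ∀ j → j ≢ k → deg G y < deg G (ys j))
      × (∀ k l → k ≢ l → ¬ CyclicSub G (P k) → ¬ CyclicSub G (P l)
           → ∀ i → deg G y < deg G (ys i))
corollary2p5 G nilpotent p α p-prime p-increasing _ _ _ P sylow y maximal ys ys∈P y≡∏ys = part-i , part-ii
  where
  open PowerGraphOfNilpotentGroup G nilpotent p α p-prime p-increasing P sylow y ys ys∈P y≡∏ys

  part-i : ∀ k → ¬ CyclicSub G (P k) → ∀ j → j ≢ k → deg G y < deg G (ys j)
  part-i = deg<deg-component maximal

  part-ii : ∀ k l → k ≢ l → ¬ CyclicSub G (P k) → ¬ CyclicSub G (P l) → ∀ i → deg G y < deg G (ys i)
  part-ii k l k≢l Pₖ-noncyclic Pₗ-noncyclic i with i ≟ k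
  ... | yes refl = part-i l Pₗ-noncyclic i k≢l
  ... | no  i≢k  = part-i k Pₖ-noncyclic i i≢k
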